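{- For $n\geq0$, \[v_{2n}=u_{2n}+u_{2n-1},\] and, with $V(x)=\sum_{n\ge0}v_{2n}x^{2n}$, $U_e(x)=\sum_{n\geq0}u_{2n}x^{2n}$, $U_o(x)=\sum_{n\geq0}u_{2n+1}x^{2n+1}$, \[V(x)=U_e(x)+xU_o(x).\]
   Context: For a multiset $M$ of positive integers, a permutation of $M$ is a word using each element of $M$ with its multiplicity. A word $w_1\cdots w_m$ contains the pattern $132$ if there are $a<b<c$ with $w_a<w_c<w_b$; otherwise it is $132$-avoiding. For $n\ge0$ let $u_{2n}$ be the number of $132$-avoiding permutations of $\{1^2,\dots,n^2\}$, $u_{2n+1}$ the number of $132$-avoiding permutations of $\{1^2,\dots,n^2,n+1\}$, and for $n\ge1$ let $v_{2n}$ be the number of $132$-avoiding permutations of $\{1^2,2^2,\dots,(n-1)^2,n,n+1\}$. Set $u_0=v_0=1$ and $u_m=v_m=0$ for $m<0$. -}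

module Defs where

open import Data.Nat using (ℕ; zero; suc; _+_; _*_; _<_; _<?_; _≟_; _≡ᵇ_; _⊔_)

open import Data.Nat.DivMod using (_/_; _%_)
open import Data.Bool using (Bool; true; false; if_then_else_)
open import Data.Fin using (Fin) renaming (_<_ to _<ᶠ_)
open import Data.Fin.Properties using (any?) renaming (_<?_ to _<ᶠ?_)
open import Data.List using (List; []; _∷_; _++_; [_]; length; lookup; filter; map; concatMap; upTo; foldr)
open import Data.List.Relation.Unary.All using (All; all?)
open import Data.Product using (Σ; _×_; _,_)
open import Relation.Nullary using (Dec; ¬_; ¬?)
open import Relation.Nullary.Decidable using (_×-dec_)
open import Relation.Binary.PropositionalEquality using (_≡_)

-- Words are lists of natural numbers; a finite multiset M of positive
-- integers is represented by any list listing its elements with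
-- multiplicity (e.g. {1^2,2^2,3} as 1 ∷ 1 ∷ 2 ∷ 2 ∷ 3 ∷ []).

occ : ℕ → List ℕ → ℕ
occ k w = length (filter (k ≟_) w)

IsPermOf : List ℕ → List ℕ → Set
IsPermOf M w = ∀ k → occ k w ≡ occ k M

Contains132 : List ℕ → Set
Contains132 w =
  Σ (Fin (length w)) λ a → Σ (Fin (length w)) λ b → Σ (Fin (length w)) λ c →
    (a <ᶠ b) × (b <ᶠ c) × (lookup w a < lookup w c) × (lookup w c < lookup w b)

Avoids132 : List ℕ → Set
Avoids132 w = ¬ Contains132 w

contains132? : (w : List ℕ) → Dec (Contains132 w)
contains132? w =
  any? λ a → any? λ b → any? λ c →
    (a <ᶠ? b) ×-dec ((b <ᶠ? c) ×-dec
      ((lookup w a <? lookup w c) ×-dec (lookup w c <? lookup w b)))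

avoids132? : (w : List ℕ) → Dec (Avoids132 w)
avoids132? w = ¬? (contains132? w)

words : List ℕ → ℕ → List (List ℕ)
words A zero    = [] ∷ []
words A (suc m) = concatMap (λ a → map (a ∷_) (words A m)) A

maxL : List ℕ → ℕ
maxL = foldr _⊔_ 0

-- alphabet 0,1,...,max M: contains every letter of M, without repetition
alphabet : List ℕ → List ℕ
alphabet M = upTo (suc (maxL M))

-- For a word over `alphabet M`, the permutation condition only needs
-- checking at the letters of `alphabet M` (all other counts are 0 on
-- both sides).
permCheck? : (M w : List ℕ) → Dec (All (λ k → occ k w ≡ occ k M) (alphabet M))
permCheck? M w = all? (λ k → occ k w ≟ occ k M) (alphabet M)

-- Number of 132-avoiding permutations of the multiset M.
-- Candidates: all words of length |M| over `alphabet M`; these are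
-- pairwise distinct and include every permutation of M.
avoiders : List ℕ → List (List ℕ)
avoiders M =
  filter avoids132? (filter (permCheck? M) (words (alphabet M) (length M)))

N132 : List ℕ → ℕ
N132 M = length (avoiders M)

doubled : ℕ → List ℕ
doubled n = concatMap (λ i → suc i ∷ suc i ∷ []) (upTo n)

-- multiset for u_m : {1^2..n^2} if m = 2n, {1^2..n^2, n+1} if m = 2n+1
uMultiset : ℕ → List ℕ
uMultiset m =
  doubled (m / 2) ++ (if (m % 2) ≡ᵇ 1 then [ suc (m / 2) ] else [])

u : ℕ → ℕ
u m = N132 (uMultiset m)

-- u_{m-1}, with the convention u_{-1} = 0
uPrev : ℕ → ℕ
uPrev zero    = 0
uPrev (suc m) = u m

-- vEven n = v_{2n}; v_0 = 1, and for n ≥ 1 v_{2n} counts the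
-- 132-avoiding permutations of {1^2,...,(n-1)^2, n, n+1}
vEven : ℕ → ℕ
vEven zero    = 1
vEven (suc n) = N132 (doubled n ++ (suc n ∷ suc (suc n) ∷ []))

Series : Set
Series = ℕ → ℕ

_+ₛ_ : Series → Series → Series
(f +ₛ g) m = f m + g m

xₛ : Series → Series
xₛ f zero    = 0
xₛ f (suc m) = f m

_≈ₛ_ : Series → Series → Set
f ≈ₛ g = ∀ m → f m ≡ g m

isEven : ℕ → Bool
isEven m = (m % 2) ≡ᵇ 0

V : Series
V m = if isEven m then vEven (m / 2) else 0

Ue : Series
Ue m = if isEven m then u m else 0

Uo : Series
Uo m = if isEven m then 0 else u m

module Submission where

-- Fix a letter c and a multiset B of letters below c. A 132-avoiding arrangement of
-- B ∪ {c, c + 1} either starts with c + 1, and deleting it leaves an arbitrary 132-avoiding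
-- arrangement of B ∪ {c}; or it does not, and then its c precedes its c + 1 (otherwise the
-- first letter, c + 1 and c form a 132), so lowering c + 1 to c is a bijection onto the
-- 132-avoiding arrangements of B ∪ {c, c}, inverted by raising the second c. With
-- B = {1², …, (n - 1)²} and c = n this is v_{2n} = u_{2n} + u_{2n-1}; the series identity
-- is the same recurrence read coefficientwise.

open import Defs
open import Data.Empty using (⊥-elim)
open import Data.Fin using (Fin; zero; suc) renaming (_<_ to _<ᶠ_)
open import Data.Nat using (ℕ; zero; suc; _+_; _*_; _<_; _≤_; _≟_; _⊓_; z≤n; s≤s; _<?_)
open import Data.Nat.DivMod using (_/_; _%_; m/n≡1+[m∸n]/n)
open import Data.Nat.Properties
open import Data.List
  using (List; []; _∷_; _++_; [_]; length; drop; lookup; filter; map; concatMap; cartesianProductWith; upTo)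
open import Data.List.Properties
  using (length-++; length-removeAt′; map-id-local; map-++; upTo-∷ʳ; concatMap-++; ++-identityʳ;
         filter-++; filter-accept; filter-reject; ∷-injective)
open import Data.List.Membership.Propositional using (_∈_; _∉_; find; lose)
open import Data.List.Membership.Propositional.Properties
  using (∈-∃++; ∈-filter⁺; ∈-filter⁻; ∈-upTo⁺; ∈-upTo⁻; ∈-lookup;
         ∈-cartesianProductWith⁺; ∈-cartesianProductWith⁻)
open import Data.List.Relation.Unary.All as All using (All; []; _∷_)
import Data.List.Relation.Unary.All.Properties as All
open import Data.List.Relation.Unary.Any as Any using (Any; here; there; _─_; index; satisfied)
open import Data.List.Relation.Unary.Any.Properties using (lookup-index) renaming (map⁻ to Any-map⁻)
open import Data.List.Relation.Unary.Unique.Propositional using (Unique; []; _∷_)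
import Data.List.Relation.Unary.Unique.Propositional.Properties as Unique
open import Data.List.Relation.Binary.Permutation.Propositional
  using (_↭_; ↭-refl; ↭-sym; ↭-trans; ↭-prep; ↭-swap; module PermutationReasoning)
open import Data.List.Relation.Binary.Permutation.Propositional.Properties
  using (↭-length; filter-↭; shift; drop-∷; ++⁺ˡ; All-resp-↭; map⁺)
open import Data.Sum using (_⊎_; inj₁; inj₂)
open import Data.Product using (Σ; ∃; _×_; _,_; proj₁; proj₂)
open import Function using (_∘_)
open import Relation.Nullary using (Dec; yes; no; ¬_; ¬?)
open import Level using (0ℓ)
open import Relation.Unary using (Pred; Decidable)
open import Relation.Binary.PropositionalEquality
  using (_≡_; _≢_; refl; sym; trans; cong; cong₂; subst; module ≡-Reasoning)

occ-++ : ∀ k v w → occ k (v ++ w) ≡ occ k v + occ k w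
occ-++ k v w = trans (cong length (filter-++ (k ≟_) v w)) (length-++ (filter (k ≟_) v))

occ-here : ∀ k w → occ k (k ∷ w) ≡ suc (occ k w)
occ-here k w = cong length (filter-accept (k ≟_) refl)

occ-there : ∀ {k x} w → k ≢ x → occ k (x ∷ w) ≡ occ k w
occ-there {k} w k≢x = cong length (filter-reject (k ≟_) k≢x)

occ-here⁻ : ∀ k w {n} → occ k (k ∷ w) ≡ suc n → occ k w ≡ n
occ-here⁻ k w e = suc-injective (trans (sym (occ-here k w)) e)

occ-there⁻ : ∀ {k x} w {n} → k ≢ x → occ k (x ∷ w) ≡ n → occ k w ≡ n
occ-there⁻ w k≢x e = trans (sym (occ-there w k≢x)) e

occ-resp-↭ : ∀ k {v w} → v ↭ w → occ k v ≡ occ k w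
occ-resp-↭ k v↭w = ↭-length (filter-↭ (k ≟_) v↭w)

∈⇒occ>0 : ∀ {k w} → k ∈ w → 0 < occ k w
∈⇒occ>0 {k} {_ ∷ w} (here refl) rewrite occ-here k w = s≤s z≤n
∈⇒occ>0 {k} {x ∷ w} (there k∈w) =
  ≤-trans (∈⇒occ>0 k∈w) (≤-trans (m≤n+m _ (occ k [ x ])) (≤-reflexive (sym (occ-++ k [ x ] w))))

occ>0⇒∈ : ∀ {k} w → 0 < occ k w → k ∈ w
occ>0⇒∈ {k} (x ∷ w) pos with k ≟ x
... | yes refl = here refl
... | no k≢x   = there (occ>0⇒∈ w (subst (0 <_) (occ-there w k≢x) pos))

∉⇒occ≡0 : ∀ {k} w → k ∉ w → occ k w ≡ 0
∉⇒occ≡0 w k∉w = n≤0⇒n≡0 (≮⇒≥ (k∉w ∘ occ>0⇒∈ w))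

occ≡0⇒∉ : ∀ {k w} → occ k w ≡ 0 → k ∉ w
occ≡0⇒∉ occ≡0 k∈w = n≮n 0 (subst (0 <_) occ≡0 (∈⇒occ>0 k∈w))

↭⇒IsPermOf : ∀ {M w} → w ↭ M → IsPermOf M w
↭⇒IsPermOf w↭M k = occ-resp-↭ k w↭M

IsPermOf⇒↭ : ∀ {M} w → IsPermOf M w → w ↭ M
IsPermOf⇒↭ {[]}    []      _    = ↭-refl
IsPermOf⇒↭ {x ∷ M} []      perm = ⊥-elim (0≢1+n (trans (perm x) (occ-here x M)))
IsPermOf⇒↭ {M}     (x ∷ w) perm
  with ∈-∃++ (occ>0⇒∈ M (subst (0 <_) (perm x) (∈⇒occ>0 {x} {x ∷ w} (here refl))))
... | ys , zs , refl = ↭-trans (↭-prep x (IsPermOf⇒↭ w perm′)) (↭-sym (shift x ys zs))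
  where
  perm′ : IsPermOf (ys ++ zs) w
  perm′ k = +-cancelˡ-≡ (occ k [ x ]) _ _ (begin
    occ k [ x ] + occ k w           ≡⟨ occ-++ k [ x ] w ⟨
    occ k (x ∷ w)                   ≡⟨ perm k ⟩
    occ k (ys ++ [ x ] ++ zs)       ≡⟨ occ-resp-↭ k (shift x ys zs) ⟩
    occ k (x ∷ ys ++ zs)            ≡⟨ occ-++ k [ x ] (ys ++ zs) ⟩
    occ k [ x ] + occ k (ys ++ zs)  ∎)
    where open ≡-Reasoning

data Has21Above (a : ℕ) : List ℕ → Set where
  start : ∀ {y v} → Any (λ z → a < z × z < y) v → Has21Above a (y ∷ v)
  skip  : ∀ {y v} → Has21Above a v → Has21Above a (y ∷ v)

data Has132 : List ℕ → Set where
  start : ∀ {x w} → Has21Above x w → Has132 (x ∷ w)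
  skip  : ∀ {x w} → Has132 w → Has132 (x ∷ w)

Has21Above⇒indices : ∀ {a w} → Has21Above a w →
  Σ (Fin (length w)) λ i → Σ (Fin (length w)) λ j →
    (i <ᶠ j) × (a < lookup w j) × (lookup w j < lookup w i)
Has21Above⇒indices (start p) = zero , suc (index p) , s≤s z≤n , lookup-index p
Has21Above⇒indices (skip d) with Has21Above⇒indices d
... | i , j , i<j , a<wj , wj<wi = suc i , suc j , s≤s i<j , a<wj , wj<wi

indices⇒Has21Above : ∀ {a} w (i j : Fin (length w)) →
  i <ᶠ j → a < lookup w j → lookup w j < lookup w i → Has21Above a w
indices⇒Has21Above (y ∷ v) zero    (suc j) _         a<wj wj<wi = start (lose (∈-lookup j) (a<wj , wj<wi))
indices⇒Has21Above (y ∷ v) (suc i) (suc j) (s≤s i<j) a<wj wj<wi = skip (indices⇒Has21Above v i j i<j a<wj wj<wi)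

Has132⇒Contains132 : ∀ {w} → Has132 w → Contains132 w
Has132⇒Contains132 (start d) with Has21Above⇒indices d
... | i , j , i<j , a<wj , wj<wi = zero , suc i , suc j , s≤s z≤n , s≤s i<j , a<wj , wj<wi
Has132⇒Contains132 (skip h) with Has132⇒Contains132 h
... | a , b , c , a<b , b<c , wa<wc , wc<wb = suc a , suc b , suc c , s≤s a<b , s≤s b<c , wa<wc , wc<wb

Contains132⇒Has132 : ∀ w → Contains132 w → Has132 w
Contains132⇒Has132 (x ∷ w) (zero , suc b , suc c , _ , s≤s b<c , wa<wc , wc<wb) =
  start (indices⇒Has21Above w b c b<c wa<wc wc<wb)
Contains132⇒Has132 (x ∷ w) (suc a , suc b , suc c , s≤s a<b , s≤s b<c , wa<wc , wc<wb) =
  skip (Contains132⇒Has132 w (a , b , c , a<b , b<c , wa<wc , wc<wb))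

Has21Above-bounded : ∀ {a w} → All (_≤ a) w → ¬ Has21Above a w
Has21Above-bounded (y≤a ∷ _)   (start p) with satisfied p
... | _ , a<z , z<y = <⇒≱ (<-trans a<z z<y) y≤a
Has21Above-bounded (_   ∷ w≤a) (skip d)  = Has21Above-bounded w≤a d

module _ {f : ℕ → ℕ} (f-reflects-< : ∀ {x y} → f x < f y → x < y) where

  Has21Above-map⁻ : ∀ {a} w → Has21Above (f a) (map f w) → Has21Above a w
  Has21Above-map⁻ (y ∷ w) (start p) =
    start (Any.map (λ (a<z , z<y) → f-reflects-< a<z , f-reflects-< z<y) (Any-map⁻ p))
  Has21Above-map⁻ (y ∷ w) (skip d)  = skip (Has21Above-map⁻ w d)

  Has132-map⁻ : ∀ w → Has132 (map f w) → Has132 w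
  Has132-map⁻ (x ∷ w) (start d) = start (Has21Above-map⁻ w d)
  Has132-map⁻ (x ∷ w) (skip h)  = skip (Has132-map⁻ w h)

data StartsWith (a : ℕ) : List ℕ → Set where
  starts : ∀ {w} → StartsWith a (a ∷ w)

startsWith? : ∀ a w → Dec (StartsWith a w)
startsWith? a []      = no λ ()
startsWith? a (x ∷ w) with x ≟ a
... | yes refl = yes starts
... | no  x≢a  = no λ { starts → x≢a refl }

maxL-upper : ∀ {z} M → z ∈ M → z ≤ maxL M
maxL-upper (x ∷ M) (here refl) = m≤m⊔n x (maxL M)
maxL-upper (x ∷ M) (there z∈M) = ≤-trans (maxL-upper M z∈M) (m≤n⊔m x (maxL M))

words-suc : ∀ (A : List ℕ) (W : List (List ℕ)) →
            concatMap (λ a → map (a ∷_) W) A ≡ cartesianProductWith _∷_ A W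
words-suc []      W = refl
words-suc (a ∷ A) W = cong (map (a ∷_) W ++_) (words-suc A W)

∈-words⁺ : ∀ {A w} → All (_∈ A) w → w ∈ words A (length w)
∈-words⁺ []                = here refl
∈-words⁺ {A} {_ ∷ w} (a∈A ∷ w∈A) =
  subst (_ ∈_) (sym (words-suc A (words A (length w)))) (∈-cartesianProductWith⁺ _∷_ a∈A (∈-words⁺ w∈A))

∈-words⁻ : ∀ {A} m {w} → w ∈ words A m → length w ≡ m × All (_∈ A) w
∈-words⁻     zero    (here refl) = refl , []
∈-words⁻ {A} (suc m) w∈
  with _ , _ , a∈A , v∈ , refl ←
         ∈-cartesianProductWith⁻ _∷_ A (words A m) (subst (_ ∈_) (words-suc A (words A m)) w∈)
  with refl , v∈A ← ∈-words⁻ m v∈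
  = refl , a∈A ∷ v∈A

words-unique : ∀ {A} m → Unique A → Unique (words A m)
words-unique     zero    _  = [] ∷ []
words-unique {A} (suc m) uA =
  subst Unique (sym (words-suc A (words A m))) (Unique.cartesianProductWith⁺ _∷_ ∷-injective uA (words-unique m uA))

∈-avoiders⁺ : ∀ {M w} → w ↭ M → ¬ Has132 w → w ∈ avoiders M
∈-avoiders⁺ {M} {w} w↭M w-avoids =
  ∈-filter⁺ avoids132? (∈-filter⁺ (permCheck? M) w∈words (All.tabulate λ {k} _ → ↭⇒IsPermOf w↭M k))
            (w-avoids ∘ Contains132⇒Has132 w)
  where
  w∈alphabet : All (_∈ alphabet M) w
  w∈alphabet = All-resp-↭ (↭-sym w↭M) (All.tabulate λ {z} z∈M → ∈-upTo⁺ (s≤s (maxL-upper M z∈M)))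
  w∈words : w ∈ words (alphabet M) (length M)
  w∈words = subst (λ m → w ∈ words (alphabet M) m) (↭-length w↭M) (∈-words⁺ w∈alphabet)

∈-avoiders⁻ : ∀ {M w} → w ∈ avoiders M → w ↭ M × ¬ Has132 w
∈-avoiders⁻ {M} {w} w∈
  with w∈perms , w-avoids ← ∈-filter⁻ avoids132? w∈
  with w∈words , perm-on-alphabet ← ∈-filter⁻ (permCheck? M) w∈perms
  with _ , w∈alphabet ← ∈-words⁻ (length M) w∈words
  = IsPermOf⇒↭ w perm , w-avoids ∘ Has132⇒Contains132
  where
  perm : IsPermOf M w
  perm k with k <? suc (maxL M)
  ... | yes k≤max = All.lookup perm-on-alphabet (∈-upTo⁺ k≤max)
  ... | no  k>max = trans (∉⇒occ≡0 w (k>max ∘ ∈-upTo⁻ ∘ All.lookup w∈alphabet))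
                          (sym (∉⇒occ≡0 M (k>max ∘ s≤s ∘ maxL-upper M)))

avoiders-unique : ∀ M → Unique (avoiders M)
avoiders-unique M =
  Unique.filter⁺ avoids132? (Unique.filter⁺ (permCheck? M) (words-unique (length M) (Unique.upTo⁺ _)))

∈-─⁺ : ∀ {A : Set} {y z : A} {ys} (y∈ys : y ∈ ys) → z ∈ ys → y ≢ z → z ∈ (ys ─ y∈ys)
∈-─⁺ (here refl) (here refl) y≢z = ⊥-elim (y≢z refl)
∈-─⁺ (here refl) (there z∈) _    = z∈
∈-─⁺ (there _)   (here refl) _   = here refl
∈-─⁺ (there y∈)  (there z∈) y≢z  = there (∈-─⁺ y∈ z∈ y≢z)

module _ {A B : Set} (f : A → B) (g : B → A) where

  length-≤-by-retraction : ∀ {xs ys} → Unique xs →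
    (∀ {x} → x ∈ xs → f x ∈ ys) → (∀ {x} → x ∈ xs → g (f x) ≡ x) → length xs ≤ length ys
  length-≤-by-retraction {[]}     _                 _    _    = z≤n
  length-≤-by-retraction {x ∷ xs} {ys} (x∉xs ∷ xs!) into retr =
    subst (suc (length xs) ≤_) (sym (length-removeAt′ ys (index fx∈ys)))
          (s≤s (length-≤-by-retraction xs! into′ (retr ∘ there)))
    where
    fx∈ys = into (here refl)
    into′ : ∀ {x′} → x′ ∈ xs → f x′ ∈ (ys ─ fx∈ys)
    into′ x′∈xs = ∈-─⁺ fx∈ys (into (there x′∈xs)) λ fx≡fx′ →
      All.lookup x∉xs x′∈xs (trans (sym (retr (here refl))) (trans (cong g fx≡fx′) (retr (there x′∈xs))))

length-≡-by-bijection : ∀ {A B : Set} (f : A → B) (g : B → A) {xs ys} → Unique xs → Unique ys →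
  (∀ {x} → x ∈ xs → f x ∈ ys) → (∀ {y} → y ∈ ys → g y ∈ xs) →
  (∀ {x} → x ∈ xs → g (f x) ≡ x) → (∀ {y} → y ∈ ys → f (g y) ≡ y) → length xs ≡ length ys
length-≡-by-bijection f g xs! ys! f-into g-into gf fg =
  ≤-antisym (length-≤-by-retraction f g xs! f-into gf) (length-≤-by-retraction g f ys! g-into fg)

length-filter-split : ∀ {A : Set} {P : Pred A 0ℓ} (P? : Decidable P) xs →
  length xs ≡ length (filter P? xs) + length (filter (¬? ∘ P?) xs)
length-filter-split P? []       = refl
length-filter-split P? (x ∷ xs) with P? x
... | yes _ = cong suc (length-filter-split P? xs)
... | no  _ = trans (cong suc (length-filter-split P? xs)) (sym (+-suc _ _))

module Raising (c : ℕ) where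

  lower : ℕ → ℕ
  lower x = x ⊓ c

  -- raise k w replaces the (k + 1)-st occurrence of c in w by suc c
  raise : ℕ → List ℕ → List ℕ
  raise k       []      = []
  raise k       (x ∷ w) with x ≟ c
  raise zero    (x ∷ w) | yes _ = suc c ∷ w
  raise (suc k) (x ∷ w) | yes _ = x ∷ raise k w
  raise k       (x ∷ w) | no  _ = x ∷ raise k w

  raise-zero-here : ∀ w → raise zero (c ∷ w) ≡ suc c ∷ w
  raise-zero-here w rewrite ≟-diag (refl {x = c}) = refl

  raise-suc-here : ∀ k w → raise (suc k) (c ∷ w) ≡ c ∷ raise k w
  raise-suc-here k w rewrite ≟-diag (refl {x = c}) = refl

  raise-there : ∀ k {x} w → x ≢ c → raise k (x ∷ w) ≡ x ∷ raise k w
  raise-there k {x} w x≢c with x ≟ c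
  ... | yes x≡c = ⊥-elim (x≢c x≡c)
  ... | no  _   = refl

  lower-reflects-< : ∀ {x y} → lower x < lower y → x < y
  lower-reflects-< {x} {y} lx<ly = ≰⇒> λ y≤x → <⇒≱ lx<ly (⊓-monoˡ-≤ c y≤x)

  lower-≤ : ∀ {x} → x ≤ c → lower x ≡ x
  lower-≤ = m≤n⇒m⊓n≡m

  lower-suc : lower (suc c) ≡ c
  lower-suc = m≥n⇒m⊓n≡n (n≤1+n c)

  map-lower-≤ : ∀ {w} → All (_≤ c) w → map lower w ≡ w
  map-lower-≤ w≤c = map-id-local (All.map lower-≤ w≤c)

  raise-↭ : ∀ k w → k < occ c w → c ∷ raise k w ↭ suc c ∷ w
  raise-↭ k       (x ∷ w) k<occ with x ≟ c
  raise-↭ zero    (x ∷ w) _     | yes refl = ↭-swap c (suc c) ↭-refl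
  raise-↭ (suc k) (x ∷ w) k<occ | yes refl =
    ↭-trans (↭-prep c (raise-↭ k w (≤-pred (subst (suc k <_) (occ-here c w) k<occ))))
            (↭-swap c (suc c) ↭-refl)
  raise-↭ k       (x ∷ w) k<occ | no  x≢c  =
    ↭-trans (↭-swap c x ↭-refl)
   (↭-trans (↭-prep x (raise-↭ k w (subst (k <_) (occ-there w (x≢c ∘ sym)) k<occ)))
            (↭-swap x (suc c) ↭-refl))

  Any-raise⁻ : ∀ {P : Pred ℕ 0ℓ} k w → ¬ P (suc c) → Any P (raise k w) → Any P w
  Any-raise⁻ k       (x ∷ w) ¬P[1+c] p         with x ≟ c
  Any-raise⁻ zero    (x ∷ w) ¬P[1+c] (here q)  | yes _ = ⊥-elim (¬P[1+c] q)
  Any-raise⁻ zero    (x ∷ w) ¬P[1+c] (there p) | yes _ = there p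
  Any-raise⁻ (suc k) (x ∷ w) ¬P[1+c] (here q)  | yes _ = here q
  Any-raise⁻ (suc k) (x ∷ w) ¬P[1+c] (there p) | yes _ = there (Any-raise⁻ k w ¬P[1+c] p)
  Any-raise⁻ k       (x ∷ w) ¬P[1+c] (here q)  | no  _ = here q
  Any-raise⁻ k       (x ∷ w) ¬P[1+c] (there p) | no  _ = there (Any-raise⁻ k w ¬P[1+c] p)

  map-lower-raise : ∀ k {w} → All (_≤ c) w → map lower (raise k w) ≡ w
  map-lower-raise k       {[]}    []          = refl
  map-lower-raise k       {x ∷ w} (x≤c ∷ w≤c) with x ≟ c
  map-lower-raise zero    {x ∷ w} (x≤c ∷ w≤c) | yes refl = cong₂ _∷_ lower-suc (map-lower-≤ w≤c)
  map-lower-raise (suc k) {x ∷ w} (x≤c ∷ w≤c) | yes _    =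
    cong₂ _∷_ (lower-≤ x≤c) (map-lower-raise k w≤c)
  map-lower-raise k       {x ∷ w} (x≤c ∷ w≤c) | no  _    =
    cong₂ _∷_ (lower-≤ x≤c) (map-lower-raise k w≤c)

  1+c-not-below : ∀ {a x} → x ≤ c → ¬ (a < suc c × suc c < x)
  1+c-not-below x≤c (_ , 1+c<x) = <⇒≱ 1+c<x (m≤n⇒m≤1+n x≤c)

  ¬startsWith-raise : ∀ k w → All (_≤ c) w → ¬ StartsWith (suc c) (raise (suc k) w)
  ¬startsWith-raise k (x ∷ w) (x≤c ∷ _) with x ≟ c
  ... | yes refl = λ ()
  ... | no  _    = λ { starts → 1+n≰n x≤c }

  -- When the raised c is the last one, the new letter c + 1 can only play the role of the 3
  -- in a 132, and then the 2 after it is at most c but not c, hence already below the old c.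
  Has21Above-raise⁻ : ∀ {a} k w → All (_≤ c) w → occ c w ≡ suc k →
                      Has21Above a (raise k w) → Has21Above a w
  Has21Above-raise⁻ k       (x ∷ w) _           _     _         with x ≟ c
  Has21Above-raise⁻ zero    (x ∷ w) _           occ≡1 (start p) | yes refl
    with z , z∈w , a<z , z<1+c ← find p
    = start (lose z∈w (a<z , ≤∧≢⇒< (≤-pred z<1+c) λ { refl → occ≡0⇒∉ (occ-here⁻ c w occ≡1) z∈w }))
  Has21Above-raise⁻ zero    (x ∷ w) _           _     (skip d)  | yes refl = skip d
  Has21Above-raise⁻ (suc k) (x ∷ w) (x≤c ∷ _)   _     (start p) | yes refl =
    start (Any-raise⁻ k w (1+c-not-below x≤c) p)
  Has21Above-raise⁻ (suc k) (x ∷ w) (_ ∷ w≤c)   occ≡  (skip d)  | yes refl =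
    skip (Has21Above-raise⁻ k w w≤c (occ-here⁻ c w occ≡) d)
  Has21Above-raise⁻ k       (x ∷ w) (x≤c ∷ _)   _     (start p) | no  _    =
    start (Any-raise⁻ k w (1+c-not-below x≤c) p)
  Has21Above-raise⁻ k       (x ∷ w) (_ ∷ w≤c)   occ≡  (skip d)  | no  x≢c  =
    skip (Has21Above-raise⁻ k w w≤c (occ-there⁻ w (x≢c ∘ sym) occ≡) d)

  Has132-raise⁻ : ∀ k w → All (_≤ c) w → occ c w ≡ suc k → Has132 (raise k w) → Has132 w
  Has132-raise⁻ k       (x ∷ w) _         _    _         with x ≟ c
  Has132-raise⁻ zero    (x ∷ w) (_ ∷ w≤c) _    (start d) | yes refl =
    ⊥-elim (Has21Above-bounded (All.map m≤n⇒m≤1+n w≤c) d)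
  Has132-raise⁻ zero    (x ∷ w) _         _    (skip h)  | yes refl = skip h
  Has132-raise⁻ (suc k) (x ∷ w) (_ ∷ w≤c) occ≡ (start d) | yes refl =
    start (Has21Above-raise⁻ k w w≤c (occ-here⁻ c w occ≡) d)
  Has132-raise⁻ (suc k) (x ∷ w) (_ ∷ w≤c) occ≡ (skip h)  | yes refl =
    skip (Has132-raise⁻ k w w≤c (occ-here⁻ c w occ≡) h)
  Has132-raise⁻ k       (x ∷ w) (_ ∷ w≤c) occ≡ (start d) | no  x≢c  =
    start (Has21Above-raise⁻ k w w≤c (occ-there⁻ w (x≢c ∘ sym) occ≡) d)
  Has132-raise⁻ k       (x ∷ w) (_ ∷ w≤c) occ≡ (skip h)  | no  x≢c  =
    skip (Has132-raise⁻ k w w≤c (occ-there⁻ w (x≢c ∘ sym) occ≡) h)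

  raise-zero-map-lower : ∀ w → All (_≤ suc c) w → c ∉ w → occ (suc c) w ≡ 1 →
                         raise zero (map lower w) ≡ w
  raise-zero-map-lower (y ∷ w) (y≤1+c ∷ w≤1+c) c∉y∷w occ≡1 with m≤n⇒m<n∨m≡n y≤1+c
  ... | inj₂ refl = begin
    raise zero (lower (suc c) ∷ map lower w)  ≡⟨ cong (λ l → raise zero (l ∷ map lower w)) lower-suc ⟩
    raise zero (c ∷ map lower w)              ≡⟨ raise-zero-here (map lower w) ⟩
    suc c ∷ map lower w                       ≡⟨ cong (suc c ∷_) (map-lower-≤ w≤c) ⟩
    suc c ∷ w                                 ∎
    where
    open ≡-Reasoning
    w≤c : All (_≤ c) w
    w≤c = All.tabulate λ {z} z∈w → ≤-pred (≤∧≢⇒< (All.lookup w≤1+c z∈w)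
                                     λ { refl → occ≡0⇒∉ (occ-here⁻ (suc c) w occ≡1) z∈w })
  ... | inj₁ y<1+c = begin
    raise zero (lower y ∷ map lower w)  ≡⟨ cong (λ l → raise zero (l ∷ map lower w)) (lower-≤ y≤c) ⟩
    raise zero (y ∷ map lower w)        ≡⟨ raise-there zero (map lower w) y≢c ⟩
    y ∷ raise zero (map lower w)        ≡⟨ cong (y ∷_) (raise-zero-map-lower w w≤1+c (c∉y∷w ∘ there)
                                             (occ-there⁻ {suc c} {y} w (λ { refl → <-irrefl refl y<1+c }) occ≡1)) ⟩
    y ∷ w                               ∎
    where
    open ≡-Reasoning
    y≤c = ≤-pred y<1+c
    y≢c : y ≢ c
    y≢c refl = c∉y∷w (here refl)

  raise-one-map-lower : ∀ w → All (_≤ suc c) w → occ c w ≡ 1 → occ (suc c) w ≡ 1 →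
                        ¬ Has132 w → ¬ StartsWith (suc c) w → raise 1 (map lower w) ≡ w
  raise-one-map-lower (y ∷ w) (y≤1+c ∷ w≤1+c) occc≡1 occ1+c≡1 avoids ¬starts
    with m≤n⇒m<n∨m≡n y≤1+c
  ... | inj₂ refl = ⊥-elim (¬starts starts)
  ... | inj₁ y<1+c with y ≟ c
  ...   | yes refl = begin
    raise 1 (lower c ∷ map lower w)  ≡⟨ cong (λ l → raise 1 (l ∷ map lower w)) (lower-≤ ≤-refl) ⟩
    raise 1 (c ∷ map lower w)        ≡⟨ raise-suc-here zero (map lower w) ⟩
    c ∷ raise zero (map lower w)     ≡⟨ cong (c ∷_) (raise-zero-map-lower w w≤1+c (occ≡0⇒∉ (occ-here⁻ c w occc≡1))
                                          (occ-there⁻ {suc c} {c} w 1+n≢n occ1+c≡1)) ⟩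
    c ∷ w                            ∎
    where open ≡-Reasoning
  ...   | no y≢c = begin
    raise 1 (lower y ∷ map lower w)  ≡⟨ cong (λ l → raise 1 (l ∷ map lower w)) (lower-≤ (≤-pred y<1+c)) ⟩
    raise 1 (y ∷ map lower w)        ≡⟨ raise-there 1 (map lower w) y≢c ⟩
    y ∷ raise 1 (map lower w)        ≡⟨ cong (y ∷_) (raise-one-map-lower w w≤1+c occc≡1′ occ1+c≡1′ (avoids ∘ skip) ¬starts′) ⟩
    y ∷ w                            ∎
    where
    open ≡-Reasoning
    occc≡1′ = occ-there⁻ w (y≢c ∘ sym) occc≡1
    occ1+c≡1′ = occ-there⁻ {suc c} {y} w (λ { refl → <-irrefl refl y<1+c }) occ1+c≡1
    -- a c after an initial c + 1 would complete the 132 pattern y (c + 1) c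
    ¬starts′ : ¬ StartsWith (suc c) w
    ¬starts′ (starts {v}) = avoids (start (start (lose c∈v (≤∧≢⇒< (≤-pred y<1+c) y≢c , n<1+n c))))
      where c∈v = occ>0⇒∈ v (subst (0 <_) (sym (occ-there⁻ {c} {suc c} v (1+n≢n ∘ sym) occc≡1′)) (s≤s z≤n))

module _ (c : ℕ) {B : List ℕ} (B<c : All (_< c) B) where

  open Raising c

  private
    Mv Mu Mo : List ℕ
    Mv = B ++ c ∷ suc c ∷ []
    Mu = B ++ c ∷ c ∷ []
    Mo = B ++ c ∷ []

    B≤c : All (_≤ c) B
    B≤c = All.map <⇒≤ B<c

    Mv≤1+c : All (_≤ suc c) Mv
    Mv≤1+c = All.++⁺ (All.map m≤n⇒m≤1+n B≤c) (n≤1+n c ∷ ≤-refl ∷ [])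

    Mu≤c : All (_≤ c) Mu
    Mu≤c = All.++⁺ B≤c (≤-refl ∷ ≤-refl ∷ [])

    Mo≤c : All (_≤ c) Mo
    Mo≤c = All.++⁺ B≤c (≤-refl ∷ [])

    occ-B++ : ∀ {k} w → c ≤ k → occ k (B ++ w) ≡ occ k w
    occ-B++ {k} w c≤k =
      trans (occ-++ k B w) (cong (_+ occ k w) (∉⇒occ≡0 B λ k∈B → <⇒≱ (All.lookup B<c k∈B) c≤k))

    occ-c-Mv : occ c Mv ≡ 1
    occ-c-Mv = trans (occ-B++ _ ≤-refl) (trans (occ-here c _) (cong suc (occ-there {c} {suc c} [] (1+n≢n ∘ sym))))

    occ-1+c-Mv : occ (suc c) Mv ≡ 1
    occ-1+c-Mv = trans (occ-B++ _ (n≤1+n c)) (trans (occ-there {suc c} {c} _ 1+n≢n) (occ-here (suc c) []))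

    occ-c-Mu : occ c Mu ≡ 2
    occ-c-Mu = trans (occ-B++ _ ≤-refl) (trans (occ-here c _) (cong suc (occ-here c [])))

    Mv↭1+c∷Mo : Mv ↭ suc c ∷ Mo
    Mv↭1+c∷Mo = ↭-trans (++⁺ˡ B (↭-swap c (suc c) ↭-refl)) (shift (suc c) B [ c ])

    c∷Mv↭1+c∷Mu : c ∷ Mv ↭ suc c ∷ Mu
    c∷Mv↭1+c∷Mu = begin
      c ∷ B ++ c ∷ suc c ∷ []      ↭⟨ shift c B _ ⟨
      B ++ c ∷ c ∷ suc c ∷ []      ↭⟨ ++⁺ˡ B (↭-prep c (↭-swap c (suc c) ↭-refl)) ⟩
      B ++ c ∷ suc c ∷ c ∷ []      ↭⟨ ++⁺ˡ B (↭-swap c (suc c) ↭-refl) ⟩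
      B ++ suc c ∷ c ∷ c ∷ []      ↭⟨ shift (suc c) B _ ⟩
      suc c ∷ B ++ c ∷ c ∷ []      ∎
      where open PermutationReasoning

    map-lower-Mv : map lower Mv ≡ Mu
    map-lower-Mv = begin
      map lower (B ++ c ∷ suc c ∷ [])                 ≡⟨ map-++ lower B _ ⟩
      map lower B ++ lower c ∷ lower (suc c) ∷ []     ≡⟨ cong (λ b → b ++ lower c ∷ lower (suc c) ∷ []) (map-lower-≤ B≤c) ⟩
      B ++ lower c ∷ lower (suc c) ∷ []               ≡⟨ cong (λ l → B ++ l ∷ lower (suc c) ∷ []) (lower-≤ ≤-refl) ⟩
      B ++ c ∷ lower (suc c) ∷ []                     ≡⟨ cong (λ l → B ++ c ∷ l ∷ []) lower-suc ⟩
      B ++ c ∷ c ∷ []                                 ∎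
      where open ≡-Reasoning

    startsHigh? : (w : List ℕ) → Dec (StartsWith (suc c) w)
    startsHigh? = startsWith? (suc c)

  private
    length-startingHigh≡N132-Mo : length (filter startsHigh? (avoiders Mv)) ≡ N132 Mo
    length-startingHigh≡N132-Mo =
      length-≡-by-bijection (drop 1) (suc c ∷_)
        (Unique.filter⁺ startsHigh? (avoiders-unique Mv)) (avoiders-unique Mo)
        into back (λ w∈ → retraction (proj₂ (∈-filter⁻ startsHigh? {xs = avoiders Mv} w∈))) (λ _ → refl)
      where
      into : ∀ {w} → w ∈ filter startsHigh? (avoiders Mv) → drop 1 w ∈ avoiders Mo
      into w∈ with ∈-filter⁻ startsHigh? {xs = avoiders Mv} w∈
      ... | w∈avoiders , starts with w↭Mv , avoids ← ∈-avoiders⁻ w∈avoiders =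
        ∈-avoiders⁺ (drop-∷ (↭-trans w↭Mv Mv↭1+c∷Mo)) (avoids ∘ skip)
      back : ∀ {w} → w ∈ avoiders Mo → suc c ∷ w ∈ filter startsHigh? (avoiders Mv)
      back {w} w∈ with w↭Mo , avoids ← ∈-avoiders⁻ w∈ =
        ∈-filter⁺ startsHigh? (∈-avoiders⁺ (↭-trans (↭-prep (suc c) w↭Mo) (↭-sym Mv↭1+c∷Mo)) avoids′) starts
        where
        avoids′ : ¬ Has132 (suc c ∷ w)
        avoids′ (start d) = Has21Above-bounded (All.map m≤n⇒m≤1+n (All-resp-↭ (↭-sym w↭Mo) Mo≤c)) d
        avoids′ (skip h)  = avoids h
      retraction : ∀ {w} → StartsWith (suc c) w → suc c ∷ drop 1 w ≡ w
      retraction starts = refl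

    length-notStartingHigh≡N132-Mu : length (filter (¬? ∘ startsHigh?) (avoiders Mv)) ≡ N132 Mu
    length-notStartingHigh≡N132-Mu =
      length-≡-by-bijection (map lower) (raise 1)
        (Unique.filter⁺ (¬? ∘ startsHigh?) (avoiders-unique Mv)) (avoiders-unique Mu)
        into back retraction section
      where
      into : ∀ {w} → w ∈ filter (¬? ∘ startsHigh?) (avoiders Mv) → map lower w ∈ avoiders Mu
      into w∈ with w↭Mv , avoids ← ∈-avoiders⁻ (proj₁ (∈-filter⁻ (¬? ∘ startsHigh?) {xs = avoiders Mv} w∈)) =
        ∈-avoiders⁺ (subst (_ ↭_) map-lower-Mv (map⁺ lower w↭Mv)) (avoids ∘ Has132-map⁻ lower-reflects-< _)
      back : ∀ {w} → w ∈ avoiders Mu → raise 1 w ∈ filter (¬? ∘ startsHigh?) (avoiders Mv)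
      back {w} w∈ with w↭Mu , avoids ← ∈-avoiders⁻ w∈ =
        ∈-filter⁺ (¬? ∘ startsHigh?) (∈-avoiders⁺ raised↭Mv (avoids ∘ Has132-raise⁻ 1 w w≤c occ-c-w))
                  (¬startsWith-raise zero w w≤c)
        where
        w≤c = All-resp-↭ (↭-sym w↭Mu) Mu≤c
        occ-c-w = trans (occ-resp-↭ c w↭Mu) occ-c-Mu
        raised↭Mv : raise 1 w ↭ Mv
        raised↭Mv = drop-∷ (begin
          c ∷ raise 1 w  ↭⟨ raise-↭ 1 w (subst (1 <_) (sym occ-c-w) ≤-refl) ⟩
          suc c ∷ w      ↭⟨ ↭-prep (suc c) w↭Mu ⟩
          suc c ∷ Mu     ↭⟨ c∷Mv↭1+c∷Mu ⟨
          c ∷ Mv         ∎)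
          where open PermutationReasoning
      retraction : ∀ {w} → w ∈ filter (¬? ∘ startsHigh?) (avoiders Mv) → raise 1 (map lower w) ≡ w
      retraction {w} w∈ with w∈avoiders , ¬starts ← ∈-filter⁻ (¬? ∘ startsHigh?) {xs = avoiders Mv} w∈
                       with w↭Mv , avoids ← ∈-avoiders⁻ w∈avoiders =
        raise-one-map-lower w (All-resp-↭ (↭-sym w↭Mv) Mv≤1+c)
          (trans (occ-resp-↭ c w↭Mv) occ-c-Mv) (trans (occ-resp-↭ (suc c) w↭Mv) occ-1+c-Mv) avoids ¬starts
      section : ∀ {w} → w ∈ avoiders Mu → map lower (raise 1 w) ≡ w
      section w∈ = map-lower-raise 1 (All-resp-↭ (↭-sym (proj₁ (∈-avoiders⁻ w∈))) Mu≤c)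

  N132-split : N132 (B ++ c ∷ suc c ∷ []) ≡ N132 (B ++ c ∷ c ∷ []) + N132 (B ++ [ c ])
  N132-split = begin
    N132 Mv            ≡⟨ length-filter-split startsHigh? (avoiders Mv) ⟩
    length (filter startsHigh? (avoiders Mv)) + length (filter (¬? ∘ startsHigh?) (avoiders Mv))
                       ≡⟨ cong₂ _+_ length-startingHigh≡N132-Mo length-notStartingHigh≡N132-Mu ⟩
    N132 Mo + N132 Mu  ≡⟨ +-comm (N132 Mo) (N132 Mu) ⟩
    N132 Mu + N132 Mo  ∎
    where open ≡-Reasoning

doubled-suc : ∀ n → doubled (suc n) ≡ doubled n ++ suc n ∷ suc n ∷ []
doubled-suc n = trans (cong (concatMap twice) (sym (upTo-∷ʳ n))) (concatMap-++ twice (upTo n) [ n ])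
  where
  twice : ℕ → List ℕ
  twice i = suc i ∷ suc i ∷ []

doubled-< : ∀ n → All (_< suc n) (doubled n)
doubled-< zero    = []
doubled-< (suc n) = subst (All (_< suc (suc n))) (sym (doubled-suc n))
  (All.++⁺ (All.map m<n⇒m<1+n (doubled-< n)) (n<1+n (suc n) ∷ n<1+n (suc n) ∷ []))

double-%2 : ∀ n → 2 * n % 2 ≡ 0
double-%2 zero    = refl
double-%2 (suc n) = trans (cong (_% 2) (*-suc 2 n)) (double-%2 n)

double+1-%2 : ∀ n → suc (2 * n) % 2 ≡ 1
double+1-%2 zero    = refl
double+1-%2 (suc n) = trans (cong (λ m → suc m % 2) (*-suc 2 n)) (double+1-%2 n)

2+m-/2 : ∀ m → (2 + m) / 2 ≡ suc (m / 2)
2+m-/2 m = m/n≡1+[m∸n]/n {2 + m} (s≤s (s≤s z≤n))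

double-/2 : ∀ n → 2 * n / 2 ≡ n
double-/2 zero    = refl
double-/2 (suc n) = trans (cong (_/ 2) (*-suc 2 n)) (trans (2+m-/2 (2 * n)) (cong suc (double-/2 n)))

double+1-/2 : ∀ n → suc (2 * n) / 2 ≡ n
double+1-/2 zero    = refl
double+1-/2 (suc n) =
  trans (cong (λ m → suc m / 2) (*-suc 2 n)) (trans (2+m-/2 (suc (2 * n))) (cong suc (double+1-/2 n)))

uMultiset-even : ∀ n → uMultiset (2 * n) ≡ doubled n
uMultiset-even n rewrite double-/2 n | double-%2 n = ++-identityʳ (doubled n)

uMultiset-odd : ∀ n → uMultiset (suc (2 * n)) ≡ doubled n ++ [ suc n ]
uMultiset-odd n rewrite double+1-/2 n | double+1-%2 n = refl

vEven≡u+uPrev : ∀ n → vEven n ≡ u (2 * n) + uPrev (2 * n)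
vEven≡u+uPrev zero    = refl
vEven≡u+uPrev (suc n) = begin
  N132 (doubled n ++ suc n ∷ suc (suc n) ∷ [])
    ≡⟨ N132-split (suc n) (doubled-< n) ⟩
  N132 (doubled n ++ suc n ∷ suc n ∷ []) + N132 (doubled n ++ [ suc n ])
    ≡⟨ cong₂ _+_ (cong N132 even) (cong N132 odd) ⟩
  u (2 * suc n) + u (suc (2 * n))
    ≡⟨ cong (λ m → u (2 * suc n) + uPrev m) (*-suc 2 n) ⟨
  u (2 * suc n) + uPrev (2 * suc n)
    ∎
  where
  open ≡-Reasoning
  even = sym (trans (uMultiset-even (suc n)) (doubled-suc n))
  odd  = sym (uMultiset-odd n)

even-or-odd : ∀ m → ∃ λ n → m ≡ 2 * n ⊎ m ≡ suc (2 * n)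
even-or-odd zero    = 0 , inj₁ refl
even-or-odd (suc m) with even-or-odd m
... | n , inj₁ refl = n , inj₂ refl
... | n , inj₂ refl = suc n , inj₁ (sym (*-suc 2 n))

V-even : ∀ n → V (2 * n) ≡ vEven n
V-even n rewrite double-%2 n = cong vEven (double-/2 n)

Ue-even : ∀ n → Ue (2 * n) ≡ u (2 * n)
Ue-even n rewrite double-%2 n = refl

xUo-even : ∀ n → xₛ Uo (2 * n) ≡ uPrev (2 * n)
xUo-even zero    = refl
xUo-even (suc n) = subst (λ m → xₛ Uo m ≡ uPrev m) (sym (*-suc 2 n)) Uo-odd
  where
  Uo-odd : Uo (suc (2 * n)) ≡ u (suc (2 * n))
  Uo-odd rewrite double+1-%2 n = refl

V≈Ue+xUo : V ≈ₛ (Ue +ₛ xₛ Uo)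
V≈Ue+xUo m with even-or-odd m
... | n , inj₁ refl = begin
  V (2 * n)                    ≡⟨ V-even n ⟩
  vEven n                      ≡⟨ vEven≡u+uPrev n ⟩
  u (2 * n) + uPrev (2 * n)    ≡⟨ cong₂ _+_ (Ue-even n) (xUo-even n) ⟨
  Ue (2 * n) + xₛ Uo (2 * n)   ∎
  where open ≡-Reasoning
... | n , inj₂ refl rewrite double+1-%2 n | double-%2 n = refl

theorem3p5 : ((n : ℕ) → vEven n ≡ u (2 * n) + uPrev (2 * n))
           × (V ≈ₛ (Ue +ₛ xₛ Uo))
theorem3p5 = vEven≡u+uPrev , V≈Ue+xUo
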